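{- Let $\mathbb K$ be a field of characteristic zero, $\mathfrak d$ a delta operator on $\mathbb K[x]$, and $\mathcal Z=(z_i)_{i\ge0}$, $\mathcal Z'=(z'_i)_{i\ge0}$ sequences in $\mathbb K$ such that for some $k\in\mathbb N$, $z_k\ne z'_k$ and $z_i=z'_i$ for all $i\ne k$. Then for $n>k$, $$t_n(x;\mathfrak d,\mathcal Z')=t_n(x;\mathfrak d,\mathcal Z)-\binom nk t_{n-k}(z'_k;\mathfrak d,\mathcal Z^{(k)})\,t_k(x;\mathfrak d,\mathcal Z),$$ while $t_n(x;\mathfrak d,\mathcal Z')=t_n(x;\mathfrak d,\mathcal Z)$ for $n\le k$.
   Context: A shift-invariant operator on $\mathbb K[x]$ is a linear operator commuting with all shifts $f(x)\mapsto f(x+a)$; a delta operator is a shift-invariant operator $\mathfrak d$ with $\mathfrak d(x)$ a nonzero constant. For a sequence $\mathcal W=(w_i)_{i\ge0}$ in $\mathbb K$, $t_n(x;\mathfrak d,\mathcal W)$ denotes the $n$-th term of the generalized Gončarov basis associated with $(\mathfrak d,\mathcal W)$: the unique sequence of polynomials $(t_n)_{n\ge0}$ with $\deg t_n=n$ and $\varepsilon_{w_i}(\mathfrak d^i t_n)=n!\,\delta_{i,n}$ for all $i,n$ ($\varepsilon_w$ evaluation at $w$, $\mathfrak d^i$ the $i$-th iterate). $\mathcal Z^{(k)}$ is the sequence whose $i$-th term is $z_{i+k}$. -}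

module Defs where

open import Level using (Level; _⊔_)
open import Algebra.Bundles using (CommutativeRing)
open import Data.Nat using (ℕ; zero; suc; _<_; _≟_)
open import Data.Nat using (_!)
open import Data.List using (List; []; _∷_)
open import Data.Product using (_×_; Σ; _,_)
open import Relation.Nullary using (¬_; yes; no)
open import Function using (_∘_)

IsField : ∀ {c ℓ} → CommutativeRing c ℓ → Set (c ⊔ ℓ)
IsField R = ¬ (1# ≈ 0#) × (∀ a → ¬ (a ≈ 0#) → Σ Carrier λ b → a * b ≈ 1#)
  where open CommutativeRing R

-- Polynomials over a commutative ring K, with coefficient lists
-- (constant term first), compared coefficientwise (so trailing zeros are irrelevant).
module Poly {c ℓ} (K : CommutativeRing c ℓ) where
  open CommutativeRing K

  fromℕ : ℕ → Carrier
  fromℕ zero = 0#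
  fromℕ (suc n) = 1# + fromℕ n

  CharZero : Set ℓ
  CharZero = ∀ n → fromℕ (suc n) ≈ 0# → Data.Empty.⊥
    where import Data.Empty

  Pol : Set c
  Pol = List Carrier

  coeff : Pol → ℕ → Carrier
  coeff [] _ = 0#
  coeff (a ∷ p) zero = a
  coeff (a ∷ p) (suc i) = coeff p i

  infix 4 _≈ₚ_
  _≈ₚ_ : Pol → Pol → Set ℓ
  p ≈ₚ q = ∀ i → coeff p i ≈ coeff q i

  HasDegree : Pol → ℕ → Set ℓ
  HasDegree p n = ¬ (coeff p n ≈ 0#) × (∀ i → n < i → coeff p i ≈ 0#)

  infixl 6 _+ₚ_ _-ₚ_
  _+ₚ_ : Pol → Pol → Pol
  [] +ₚ q = q
  (a ∷ p) +ₚ [] = a ∷ p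
  (a ∷ p) +ₚ (b ∷ q) = (a + b) ∷ (p +ₚ q)

  infixl 7 _·ₚ_
  _·ₚ_ : Carrier → Pol → Pol
  a ·ₚ [] = []
  a ·ₚ (b ∷ p) = (a * b) ∷ (a ·ₚ p)

  _-ₚ_ : Pol → Pol → Pol
  p -ₚ q = p +ₚ ((- 1#) ·ₚ q)

  const : Carrier → Pol
  const a = a ∷ []

  X : Pol
  X = 0# ∷ 1# ∷ []

  eval : Carrier → Pol → Carrier
  eval w [] = 0#
  eval w (a ∷ p) = a + w * eval w p

  -- shift: f(x) ↦ f(x + a), computed by Horner's scheme with (x + a) · g = x·g + a·g
  shift : Carrier → Pol → Pol
  shift a [] = []
  shift a (b ∷ p) = const b +ₚ ((0# ∷ g) +ₚ (a ·ₚ g))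
    where g = shift a p

  Operator : Set c
  Operator = Pol → Pol

  IsLinear : Operator → Set (c ⊔ ℓ)
  IsLinear T = (∀ p q → p ≈ₚ q → T p ≈ₚ T q)
             × (∀ p q → T (p +ₚ q) ≈ₚ T p +ₚ T q)
             × (∀ a p → T (a ·ₚ p) ≈ₚ a ·ₚ T p)

  IsShiftInvariant : Operator → Set (c ⊔ ℓ)
  IsShiftInvariant T = IsLinear T × (∀ a p → T (shift a p) ≈ₚ shift a (T p))

  IsDeltaOperator : Operator → Set (c ⊔ ℓ)
  IsDeltaOperator T = IsShiftInvariant T
                    × Σ Carrier (λ a → ¬ (a ≈ 0#) × (T X ≈ₚ const a))

  iter : Operator → ℕ → Operator
  iter T zero = λ p → p
  iter T (suc i) = T ∘ iter T i

  factDelta : ℕ → ℕ → Carrier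
  factDelta i n with i ≟ n
  ... | yes _ = fromℕ (n !)
  ... | no _ = 0#

  IsGoncarovBasis : Operator → (ℕ → Carrier) → (ℕ → Pol) → Set ℓ
  IsGoncarovBasis D W t = (∀ n → HasDegree (t n) n)
                        × (∀ i n → eval (W i) (iter D i (t n)) ≈ factDelta i n)

  tailSeq : ℕ → (ℕ → Carrier) → (ℕ → Carrier)
  tailSeq k Z i = Z (i Data.Nat.+ k)

-- Write εᵢ(p) = ε_{wᵢ}(𝔡ⁱ p). Over a field of characteristic zero a polynomial is
-- determined by its values under all εᵢ: peel off multiples of the basis elements t_N
-- from the top degree down, using εᵢ(t_N) = 0 for i < N and ε_N(t_N) = N! ≠ 0.
-- Since ε_{z_{i+k}} 𝔡ⁱ (𝔡ᵏ p) = ε_{z_{i+k}} 𝔡^{i+k} p, this uniqueness gives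
-- 𝔡ᵏ t_n = (n choose k) k! s_{n-k} for n ≥ k and 𝔡ᵏ t_n = 0 for n < k, where (s_m) is
-- the basis for 𝒵^{(k)}. As 𝒵 and 𝒵′ differ only at k, a candidate for t′_n inherits
-- all conditions from (t_m) except the one at i = k, and those two formulas (with
-- s_0 = 1) verify it.
module Submission where

open import Defs
open import Algebra.Bundles using (CommutativeRing)
open import Data.Nat using (ℕ; zero; suc; _≤_; _<_; _∸_; _≟_; z≤n; s≤s; _!; _/_) renaming (_+_ to _+ℕ_; _*_ to _*ℕ_)
open import Data.Nat.Properties
  using (≤∧≢⇒<; <⇒≢; <⇒≱; m≤n+m; m+n∸n≡m; m∸n+n≡m; n∸n≡0; <⇒≤; ≤-refl; m<n⇒m<1+n; n<1+n;
         m≤n⇒m<n∨m≡n; 1≤n!; _!*_!≢0)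
  renaming (*-assoc to *ℕ-assoc)
open import Data.Nat.Combinatorics using (_C_; nCn≡1; k![n∸k]!∣n!)
open import Data.Nat.Combinatorics.Specification using (nCk≡n!/k![n-k]!)
open import Data.Nat.DivMod using (m/n*n≡m)
open import Data.List using ([]; _∷_; length)
open import Data.Product using (_×_; _,_; proj₁; proj₂)
open import Data.Sum using (inj₁; inj₂)
open import Data.Maybe using (nothing)
open import Data.Empty using (⊥-elim)
open import Relation.Nullary using (¬_; yes; no)
open import Relation.Binary.PropositionalEquality as ≡ using (_≡_; _≢_)
open import Tactic.RingSolver.Core.AlmostCommutativeRing using (fromCommutativeRing)

nCk*k!*[n∸k]!≡n! : ∀ {n k} → k ≤ n → (n C k) *ℕ k ! *ℕ (n ∸ k) ! ≡ n !
nCk*k!*[n∸k]!≡n! {n} {k} k≤n = begin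
  (n C k) *ℕ k ! *ℕ (n ∸ k) !                    ≡⟨ *ℕ-assoc (n C k) (k !) ((n ∸ k) !) ⟩
  (n C k) *ℕ (k ! *ℕ (n ∸ k) !)                  ≡⟨ ≡.cong (_*ℕ (k ! *ℕ (n ∸ k) !)) (nCk≡n!/k![n-k]! k≤n) ⟩
  n ! / (k ! *ℕ (n ∸ k) !) *ℕ (k ! *ℕ (n ∸ k) !) ≡⟨ m/n*n≡m (k![n∸k]!∣n! k≤n) ⟩
  n !                                            ∎
  where
  open ≡.≡-Reasoning
  instance _ = k !* (n ∸ k) !≢0

module PolynomialProperties {c ℓ} (K : CommutativeRing c ℓ) where
  open CommutativeRing K hiding (zero)
  open Poly K
  open import Algebra.Properties.Ring ring using (-1*x≈-x)
  open import Algebra.Properties.Semiring.Mult semiring using (×1-homo-*) renaming (_×_ to _×ₙ_)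
  open import Tactic.RingSolver.NonReflective (fromCommutativeRing K (λ _ → nothing))
  open import Relation.Binary.Reasoning.Setoid setoid

  -- _≈ₚ_ is a function type, from which Agda cannot infer the two polynomials.
  record _≋_ (p q : Pol) : Set ℓ where
    constructor ⟪_⟫
    field coeffwise : p ≈ₚ q
  open _≋_ public
  infix 4 _≋_

  ≋-refl : ∀ {p} → p ≋ p
  ≋-refl = ⟪ (λ i → refl) ⟫

  ≋-sym : ∀ {p q} → p ≋ q → q ≋ p
  ≋-sym e = ⟪ (λ i → sym (coeffwise e i)) ⟫

  ≋-trans : ∀ {p q r} → p ≋ q → q ≋ r → p ≋ r
  ≋-trans e f = ⟪ (λ i → trans (coeffwise e i) (coeffwise f i)) ⟫

  coeff-+ₚ : ∀ p q i → coeff (p +ₚ q) i ≈ coeff p i + coeff q i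
  coeff-+ₚ []      q       i       = sym (+-identityˡ _)
  coeff-+ₚ (a ∷ p) []      i       = sym (+-identityʳ _)
  coeff-+ₚ (a ∷ p) (b ∷ q) zero    = refl
  coeff-+ₚ (a ∷ p) (b ∷ q) (suc i) = coeff-+ₚ p q i

  coeff-·ₚ : ∀ a p i → coeff (a ·ₚ p) i ≈ a * coeff p i
  coeff-·ₚ a []      i       = sym (zeroʳ a)
  coeff-·ₚ a (b ∷ p) zero    = refl
  coeff-·ₚ a (b ∷ p) (suc i) = coeff-·ₚ a p i

  coeff--ₚ : ∀ p q i → coeff (p -ₚ q) i ≈ coeff p i - coeff q i
  coeff--ₚ p q i = trans (coeff-+ₚ p _ i) (+-congˡ (trans (coeff-·ₚ _ q i) (-1*x≈-x _)))

  +ₚ-cong : ∀ {p p′ q q′} → p ≋ p′ → q ≋ q′ → p +ₚ q ≋ p′ +ₚ q′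
  +ₚ-cong {p} {p′} {q} {q′} e f = ⟪ (λ i → begin
    coeff (p +ₚ q) i       ≈⟨ coeff-+ₚ p q i ⟩
    coeff p i + coeff q i   ≈⟨ +-cong (coeffwise e i) (coeffwise f i) ⟩
    coeff p′ i + coeff q′ i ≈⟨ coeff-+ₚ p′ q′ i ⟨
    coeff (p′ +ₚ q′) i     ∎) ⟫

  ·ₚ-zeroˡ : ∀ {a} q → a ≈ 0# → a ·ₚ q ≋ []
  ·ₚ-zeroˡ {a} q a≈0 = ⟪ (λ i → trans (coeff-·ₚ a q i) (trans (*-congʳ a≈0) (zeroˡ _))) ⟫

  p≋[p-q]+q : ∀ p q → p ≋ (p -ₚ q) +ₚ q
  p≋[p-q]+q p q = ⟪ (λ i → sym (begin
    coeff ((p -ₚ q) +ₚ q) i             ≈⟨ coeff-+ₚ (p -ₚ q) q i ⟩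
    coeff (p -ₚ q) i + coeff q i        ≈⟨ +-congʳ (coeff--ₚ p q i) ⟩
    coeff p i - coeff q i + coeff q i   ≈⟨ +-assoc _ _ _ ⟩
    coeff p i + (- coeff q i + coeff q i) ≈⟨ +-congˡ (-‿inverseˡ _) ⟩
    coeff p i + 0#                      ≈⟨ +-identityʳ _ ⟩
    coeff p i                           ∎)) ⟫

  p-q≋[]⇒p≋q : ∀ p q → p -ₚ q ≋ [] → p ≋ q
  p-q≋[]⇒p≋q p q e = ≋-trans (p≋[p-q]+q p q) (+ₚ-cong e ≋-refl)

  eval-[]≈ₚ : ∀ w q → [] ≈ₚ q → 0# ≈ eval w q
  eval-[]≈ₚ w []      _ = refl
  eval-[]≈ₚ w (b ∷ q) h = begin
    0#               ≈⟨ +-identityʳ 0# ⟨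
    0# + 0#          ≈⟨ +-congˡ (zeroʳ w) ⟨
    0# + w * 0#      ≈⟨ +-cong (h zero) (*-congˡ (eval-[]≈ₚ w q (λ i → h (suc i)))) ⟩
    b + w * eval w q ∎

  eval-cong : ∀ w {p q} → p ≋ q → eval w p ≈ eval w q
  eval-cong w {p} {q} e = go p q (coeffwise e)
    where
    go : ∀ p q → p ≈ₚ q → eval w p ≈ eval w q
    go []      q       h = eval-[]≈ₚ w q h
    go (a ∷ p) []      h = sym (eval-[]≈ₚ w (a ∷ p) (λ i → sym (h i)))
    go (a ∷ p) (b ∷ q) h = +-cong (h zero) (*-congˡ (go p q (λ i → h (suc i))))

  eval-at-≈ : ∀ {w w′} p → w ≈ w′ → eval w p ≈ eval w′ p
  eval-at-≈ []      _ = refl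
  eval-at-≈ (a ∷ p) e = +-congˡ (*-cong e (eval-at-≈ p e))

  eval-+ₚ : ∀ w p q → eval w (p +ₚ q) ≈ eval w p + eval w q
  eval-+ₚ w []      q       = sym (+-identityˡ _)
  eval-+ₚ w (a ∷ p) []      = sym (+-identityʳ _)
  eval-+ₚ w (a ∷ p) (b ∷ q) =
    trans (+-congˡ (*-congˡ (eval-+ₚ w p q))) (horner a b w (eval w p) (eval w q))
    where
    horner : ∀ a b w x y → (a + b) + w * (x + y) ≈ (a + w * x) + (b + w * y)
    horner = solve 5 (λ a b w x y → ((a ⊕ b) ⊕ w ⊗ (x ⊕ y)) ⊜ ((a ⊕ w ⊗ x) ⊕ (b ⊕ w ⊗ y))) refl

  eval-·ₚ : ∀ w a p → eval w (a ·ₚ p) ≈ a * eval w p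
  eval-·ₚ w a []      = sym (zeroʳ a)
  eval-·ₚ w a (b ∷ p) =
    trans (+-congˡ (*-congˡ (eval-·ₚ w a p))) (horner a b w (eval w p))
    where
    horner : ∀ a b w x → a * b + w * (a * x) ≈ a * (b + w * x)
    horner = solve 4 (λ a b w x → (a ⊗ b ⊕ w ⊗ (a ⊗ x)) ⊜ a ⊗ (b ⊕ w ⊗ x)) refl

  DegreeBelow : ℕ → Pol → Set ℓ
  DegreeBelow N p = ∀ i → N ≤ i → coeff p i ≈ 0#

  degreeBelow-length : ∀ p → DegreeBelow (length p) p
  degreeBelow-length []      i       _         = refl
  degreeBelow-length (a ∷ p) (suc i) (s≤s N≤i) = degreeBelow-length p i N≤i

  degreeBelow-0 : ∀ p → DegreeBelow 0 p → p ≋ []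
  degreeBelow-0 p d = ⟪ (λ i → d i z≤n) ⟫

  degreeBelow-1⇒eval : ∀ p → DegreeBelow 1 p → ∀ w → eval w p ≈ coeff p 0
  degreeBelow-1⇒eval p d w = begin
    eval w p                   ≈⟨ eval-cong w p≋const ⟩
    coeff p 0 + w * 0#         ≈⟨ +-congˡ (zeroʳ w) ⟩
    coeff p 0 + 0#             ≈⟨ +-identityʳ _ ⟩
    coeff p 0                  ∎
    where
    p≋const : p ≋ const (coeff p 0)
    p≋const = ⟪ (λ { zero → refl ; (suc i) → d (suc i) (s≤s z≤n) }) ⟫

  fromℕ≈×1 : ∀ n → fromℕ n ≈ n ×ₙ 1#
  fromℕ≈×1 zero    = refl
  fromℕ≈×1 (suc n) = +-congˡ (fromℕ≈×1 n)

  fromℕ-* : ∀ m n → fromℕ (m *ℕ n) ≈ fromℕ m * fromℕ n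
  fromℕ-* m n = begin
    fromℕ (m *ℕ n)        ≈⟨ fromℕ≈×1 (m *ℕ n) ⟩
    (m *ℕ n) ×ₙ 1#        ≈⟨ ×1-homo-* m n ⟩
    (m ×ₙ 1#) * (n ×ₙ 1#) ≈⟨ *-cong (fromℕ≈×1 m) (fromℕ≈×1 n) ⟨
    fromℕ m * fromℕ n     ∎

  factDelta-≢ : ∀ {i n} → i ≢ n → factDelta i n ≈ 0#
  factDelta-≢ {i} {n} i≢n with i ≟ n
  ... | yes i≡n = ⊥-elim (i≢n i≡n)
  ... | no _    = refl

  factDelta-≡ : ∀ n → factDelta n n ≈ fromℕ (n !)
  factDelta-≡ n with n ≟ n
  ... | yes _   = refl
  ... | no n≢n = ⊥-elim (n≢n ≡.refl)

  factDelta-+ : ∀ i {k n} → k ≤ n →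
    factDelta (i +ℕ k) n ≈ (fromℕ (n C k) * fromℕ (k !)) * factDelta i (n ∸ k)
  factDelta-+ i {k} {n} k≤n with i +ℕ k ≟ n | i ≟ n ∸ k
  ... | yes _    | yes _     = sym (begin
    fromℕ (n C k) * fromℕ (k !) * fromℕ ((n ∸ k) !) ≈⟨ *-congʳ (fromℕ-* (n C k) (k !)) ⟨
    fromℕ ((n C k) *ℕ k !) * fromℕ ((n ∸ k) !)      ≈⟨ fromℕ-* ((n C k) *ℕ k !) ((n ∸ k) !) ⟨
    fromℕ ((n C k) *ℕ k ! *ℕ (n ∸ k) !)             ≡⟨ ≡.cong fromℕ (nCk*k!*[n∸k]!≡n! k≤n) ⟩
    fromℕ (n !)                                     ∎)
  ... | yes i+k≡n | no i≢n∸k = ⊥-elim (i≢n∸k (≡.trans (≡.sym (m+n∸n≡m i k)) (≡.cong (_∸ k) i+k≡n)))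
  ... | no i+k≢n | yes i≡n∸k = ⊥-elim (i+k≢n (≡.trans (≡.cong (_+ℕ k) i≡n∸k) (m∸n+n≡m k≤n)))
  ... | no _     | no _      = sym (zeroʳ _)

module LinearOperatorProperties {c ℓ} (K : CommutativeRing c ℓ)
                                (D : Poly.Operator K) (lin : Poly.IsLinear K D) where
  open CommutativeRing K hiding (zero)
  open Poly K
  open PolynomialProperties K
  open import Algebra.Properties.Ring ring using (-1*x≈-x)
  open import Relation.Binary.Reasoning.Setoid setoid

  D-cong : ∀ {p q} → p ≋ q → D p ≋ D q
  D-cong e = ⟪ proj₁ lin _ _ (coeffwise e) ⟫

  iter-cong : ∀ i {p q} → p ≋ q → iter D i p ≋ iter D i q
  iter-cong zero    e = e
  iter-cong (suc i) e = D-cong (iter-cong i e)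

  iter-+ₚ : ∀ i p q → iter D i (p +ₚ q) ≋ iter D i p +ₚ iter D i q
  iter-+ₚ zero    p q = ≋-refl
  iter-+ₚ (suc i) p q = ≋-trans (D-cong (iter-+ₚ i p q)) ⟪ proj₁ (proj₂ lin) _ _ ⟫

  iter-·ₚ : ∀ i a p → iter D i (a ·ₚ p) ≋ a ·ₚ iter D i p
  iter-·ₚ zero    a p = ≋-refl
  iter-·ₚ (suc i) a p = ≋-trans (D-cong (iter-·ₚ i a p)) ⟪ proj₂ (proj₂ lin) _ _ ⟫

  iter-+ : ∀ i k p → iter D i (iter D k p) ≡ iter D (i +ℕ k) p
  iter-+ zero    k p = ≡.refl
  iter-+ (suc i) k p = ≡.cong D (iter-+ i k p)

  εD : (ℕ → Carrier) → ℕ → Pol → Carrier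
  εD W i p = eval (W i) (iter D i p)

  εD-cong : ∀ W i {p q} → p ≋ q → εD W i p ≈ εD W i q
  εD-cong W i e = eval-cong (W i) (iter-cong i e)

  εD-+ₚ : ∀ W i p q → εD W i (p +ₚ q) ≈ εD W i p + εD W i q
  εD-+ₚ W i p q = trans (eval-cong (W i) (iter-+ₚ i p q)) (eval-+ₚ (W i) (iter D i p) (iter D i q))

  εD-·ₚ : ∀ W i a p → εD W i (a ·ₚ p) ≈ a * εD W i p
  εD-·ₚ W i a p = trans (eval-cong (W i) (iter-·ₚ i a p)) (eval-·ₚ (W i) a (iter D i p))

  εD--ₚ : ∀ W i p q → εD W i (p -ₚ q) ≈ εD W i p - εD W i q
  εD--ₚ W i p q = trans (εD-+ₚ W i p _) (+-congˡ (trans (εD-·ₚ W i _ q) (-1*x≈-x _)))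

  εD-[] : ∀ W i → εD W i [] ≈ 0#
  εD-[] W i = trans (εD-·ₚ W i 0# []) (zeroˡ _)

  εD-tailSeq : ∀ W k i p → εD (tailSeq k W) i (iter D k p) ≡ εD W (i +ℕ k) p
  εD-tailSeq W k i p = ≡.cong (eval (W (i +ℕ k))) (iter-+ i k p)

  eval-basis₀ : ∀ {W u} → IsGoncarovBasis D W u → ∀ w → eval w (u 0) ≈ 1#
  eval-basis₀ {W} {u} (deg , val) w = begin
    eval w (u 0)     ≈⟨ degreeBelow-1⇒eval (u 0) (proj₂ (deg 0)) w ⟩
    coeff (u 0) 0    ≈⟨ degreeBelow-1⇒eval (u 0) (proj₂ (deg 0)) (W 0) ⟨
    eval (W 0) (u 0) ≈⟨ val 0 0 ⟩
    factDelta 0 0    ≈⟨ +-identityʳ 1# ⟩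
    1#               ∎

module GoncarovUniqueness {c ℓ} (K : CommutativeRing c ℓ) (field′ : IsField K) (charZero : Poly.CharZero K)
                          (D : Poly.Operator K) (lin : Poly.IsLinear K D)
                          (W : ℕ → CommutativeRing.Carrier K) (u : ℕ → Poly.Pol K)
                          (basis : Poly.IsGoncarovBasis K D W u) where
  open CommutativeRing K hiding (zero)
  open Poly K
  open PolynomialProperties K
  open LinearOperatorProperties K D lin
  open import Relation.Binary.Reasoning.Setoid setoid

  fromℕ-!≉0 : ∀ n → ¬ fromℕ (n !) ≈ 0#
  fromℕ-!≉0 n with n ! | 1≤n! n
  ... | suc m | _ = charZero m

  *-cancelʳ-≈0 : ∀ a {b} → ¬ b ≈ 0# → a * b ≈ 0# → a ≈ 0#
  *-cancelʳ-≈0 a {b} b≉0 ab≈0 with proj₂ field′ b b≉0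
  ... | b⁻¹ , bb⁻¹≈1 = begin
    a              ≈⟨ *-identityʳ a ⟨
    a * 1#         ≈⟨ *-congˡ bb⁻¹≈1 ⟨
    a * (b * b⁻¹)  ≈⟨ *-assoc a b b⁻¹ ⟨
    (a * b) * b⁻¹  ≈⟨ *-congʳ ab≈0 ⟩
    0# * b⁻¹       ≈⟨ zeroˡ b⁻¹ ⟩
    0#             ∎

  leadingRatio : ℕ → Pol → Carrier
  leadingRatio N p = coeff p N * proj₁ (proj₂ field′ (coeff (u N) N) (proj₁ (proj₁ basis N)))

  leadingRatio-* : ∀ N p → leadingRatio N p * coeff (u N) N ≈ coeff p N
  leadingRatio-* N p with proj₂ field′ (coeff (u N) N) (proj₁ (proj₁ basis N))
  ... | b⁻¹ , bb⁻¹≈1 = begin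
    (coeff p N * b⁻¹) * b  ≈⟨ *-assoc _ _ _ ⟩
    coeff p N * (b⁻¹ * b)  ≈⟨ *-congˡ (trans (*-comm b⁻¹ b) bb⁻¹≈1) ⟩
    coeff p N * 1#         ≈⟨ *-identityʳ _ ⟩
    coeff p N              ∎
    where b = coeff (u N) N

  reduceDegree : ∀ N p → DegreeBelow (suc N) p → DegreeBelow N (p -ₚ leadingRatio N p ·ₚ u N)
  reduceDegree N p d i N≤i = begin
    coeff (p -ₚ α ·ₚ u N) i       ≈⟨ coeff--ₚ p _ i ⟩
    coeff p i - coeff (α ·ₚ u N) i ≈⟨ +-congˡ (-‿cong (coeff-·ₚ α (u N) i)) ⟩
    coeff p i - α * coeff (u N) i ≈⟨ top i N≤i ⟩
    0#                            ∎
    where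
    α = leadingRatio N p
    top : ∀ i → N ≤ i → coeff p i - α * coeff (u N) i ≈ 0#
    top i N≤i with N ≟ i
    ... | yes ≡.refl = trans (+-congˡ (-‿cong (leadingRatio-* N p))) (-‿inverseʳ _)
    ... | no N≢i = begin
      coeff p i - α * coeff (u N) i ≈⟨ +-cong (d i N<i) (-‿cong (*-congˡ (proj₂ (proj₁ basis N) i N<i))) ⟩
      0# - α * 0#                   ≈⟨ +-congˡ (-‿cong (zeroʳ α)) ⟩
      0# - 0#                       ≈⟨ -‿inverseʳ 0# ⟩
      0#                            ∎
      where N<i = ≤∧≢⇒< N≤i N≢i

  εD-basis-below : ∀ {i N} → i < N → εD W i (u N) ≈ 0#
  εD-basis-below {i} {N} i<N = trans (proj₂ basis i N) (factDelta-≢ (<⇒≢ i<N))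

  εD-vanishing⇒≋[] : ∀ N p → DegreeBelow N p → (∀ i → i < N → εD W i p ≈ 0#) → p ≋ []
  εD-vanishing⇒≋[] zero    p d _ = degreeBelow-0 p d
  εD-vanishing⇒≋[] (suc N) p d vanish =
    ≋-trans (p≋[p-q]+q p (α ·ₚ u N)) (+ₚ-cong p′≋[] (·ₚ-zeroˡ (u N) α≈0))
    where
    α = leadingRatio N p
    p′ = p -ₚ α ·ₚ u N
    vanish′ : ∀ i → i < N → εD W i p′ ≈ 0#
    vanish′ i i<N = begin
      εD W i p′                     ≈⟨ εD--ₚ W i p _ ⟩
      εD W i p - εD W i (α ·ₚ u N)  ≈⟨ +-cong (vanish i (m<n⇒m<1+n i<N)) (-‿cong (εD-·ₚ W i α (u N))) ⟩
      0# - α * εD W i (u N)         ≈⟨ +-congˡ (-‿cong (trans (*-congˡ (εD-basis-below i<N)) (zeroʳ α))) ⟩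
      0# - 0#                       ≈⟨ -‿inverseʳ 0# ⟩
      0#                            ∎
    p′≋[] : p′ ≋ []
    p′≋[] = εD-vanishing⇒≋[] N p′ (reduceDegree N p d) vanish′
    α≈0 : α ≈ 0#
    α≈0 = *-cancelʳ-≈0 α (fromℕ-!≉0 N) (begin
      α * fromℕ (N !)                 ≈⟨ *-congˡ (trans (proj₂ basis N N) (factDelta-≡ N)) ⟨
      α * εD W N (u N)                ≈⟨ +-identityˡ _ ⟨
      0# + α * εD W N (u N)           ≈⟨ +-cong (trans (εD-cong W N p′≋[]) (εD-[] W N)) (εD-·ₚ W N α (u N)) ⟨
      εD W N p′ + εD W N (α ·ₚ u N)   ≈⟨ εD-+ₚ W N p′ _ ⟨
      εD W N (p′ +ₚ α ·ₚ u N)         ≈⟨ εD-cong W N (p≋[p-q]+q p (α ·ₚ u N)) ⟨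
      εD W N p                        ≈⟨ vanish N (n<1+n N) ⟩
      0#                              ∎)

  εD-injective : ∀ {p q} → (∀ i → εD W i p ≈ εD W i q) → p ≋ q
  εD-injective {p} {q} same = p-q≋[]⇒p≋q p q
    (εD-vanishing⇒≋[] (length (p -ₚ q)) (p -ₚ q) (degreeBelow-length (p -ₚ q))
      (λ i _ → trans (εD--ₚ W i p q) (trans (+-congʳ (same i)) (-‿inverseʳ _))))

  ≋-basis : ∀ {p} n → (∀ i → εD W i p ≈ factDelta i n) → p ≋ u n
  ≋-basis n εD-p = εD-injective (λ i → trans (εD-p i) (sym (proj₂ basis i n)))

module ChangeOfNode {c ℓ} (K : CommutativeRing c ℓ) (field′ : IsField K) (charZero : Poly.CharZero K)
                    (D : Poly.Operator K) (lin : Poly.IsLinear K D)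
                    (Z Z′ : ℕ → CommutativeRing.Carrier K) (k : ℕ)
                    (Z≈Z′ : ∀ i → i ≢ k → CommutativeRing._≈_ K (Z i) (Z′ i))
                    (t t′ s : ℕ → Poly.Pol K)
                    (t-basis : Poly.IsGoncarovBasis K D Z t) (t′-basis : Poly.IsGoncarovBasis K D Z′ t′)
                    (s-basis : Poly.IsGoncarovBasis K D (Poly.tailSeq K k Z) s) where
  open CommutativeRing K hiding (zero)
  open Poly K
  open PolynomialProperties K
  open LinearOperatorProperties K D lin
  open import Algebra.Properties.Ring ring using (-0#≈0#)
  open import Relation.Binary.Reasoning.Setoid setoid
  module T′ = GoncarovUniqueness K field′ charZero D lin Z′ t′ t′-basis
  module S = GoncarovUniqueness K field′ charZero D lin (tailSeq k Z) s s-basis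

  εDᵏ-t : ∀ i n → εD (tailSeq k Z) i (iter D k (t n)) ≈ factDelta (i +ℕ k) n
  εDᵏ-t i n = ≡.subst (_≈ factDelta (i +ℕ k) n) (≡.sym (εD-tailSeq Z k i (t n)))
                      (proj₂ t-basis (i +ℕ k) n)

  iterᵏ-t : ∀ n → k ≤ n → iter D k (t n) ≋ (fromℕ (n C k) * fromℕ (k !)) ·ₚ s (n ∸ k)
  iterᵏ-t n k≤n = S.εD-injective λ i → begin
    εD (tailSeq k Z) i (iter D k (t n))        ≈⟨ εDᵏ-t i n ⟩
    factDelta (i +ℕ k) n                      ≈⟨ factDelta-+ i k≤n ⟩
    γ * factDelta i (n ∸ k)                   ≈⟨ *-congˡ (proj₂ s-basis i (n ∸ k)) ⟨
    γ * εD (tailSeq k Z) i (s (n ∸ k))        ≈⟨ εD-·ₚ (tailSeq k Z) i γ (s (n ∸ k)) ⟨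
    εD (tailSeq k Z) i (γ ·ₚ s (n ∸ k))       ∎
    where γ = fromℕ (n C k) * fromℕ (k !)

  iterᵏ-t-below : ∀ n → n < k → iter D k (t n) ≋ []
  iterᵏ-t-below n n<k = S.εD-vanishing⇒≋[] (length Dᵏtₙ) Dᵏtₙ (degreeBelow-length Dᵏtₙ) λ i _ →
    trans (εDᵏ-t i n) (factDelta-≢ (λ i+k≡n → <⇒≱ n<k (≡.subst (k ≤_) i+k≡n (m≤n+m k i))))
    where Dᵏtₙ = iter D k (t n)

  eval-iterᵏ-tₖ : ∀ w → eval w (iter D k (t k)) ≈ fromℕ (k !)
  eval-iterᵏ-tₖ w = begin
    eval w (iter D k (t k))                              ≈⟨ eval-cong w (iterᵏ-t k ≤-refl) ⟩
    eval w ((fromℕ (k C k) * fromℕ (k !)) ·ₚ s (k ∸ k))  ≈⟨ eval-·ₚ w _ (s (k ∸ k)) ⟩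
    (fromℕ (k C k) * fromℕ (k !)) * eval w (s (k ∸ k))   ≡⟨ ≡.cong₂ (λ m r → (fromℕ m * fromℕ (k !)) * eval w (s r))
                                                                    (nCn≡1 k) (n∸n≡0 k) ⟩
    ((1# + 0#) * fromℕ (k !)) * eval w (s 0)             ≈⟨ *-cong (*-congʳ (+-identityʳ 1#)) (eval-basis₀ s-basis w) ⟩
    (1# * fromℕ (k !)) * 1#                              ≈⟨ trans (*-identityʳ _) (*-identityˡ _) ⟩
    fromℕ (k !)                                          ∎

  εD′-t-≢ : ∀ {i} n → i ≢ k → εD Z′ i (t n) ≈ factDelta i n
  εD′-t-≢ {i} n i≢k = trans (eval-at-≈ (iter D i (t n)) (sym (Z≈Z′ i i≢k))) (proj₂ t-basis i n)

  εD′-t-upTo : ∀ n → n ≤ k → ∀ i → εD Z′ i (t n) ≈ factDelta i n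
  εD′-t-upTo n n≤k i with i ≟ k | m≤n⇒m<n∨m≡n n≤k
  ... | no i≢k     | _           = εD′-t-≢ n i≢k
  ... | yes ≡.refl | inj₁ n<k    = trans (eval-cong (Z′ k) (iterᵏ-t-below n n<k))
                                         (sym (factDelta-≢ (λ k≡n → <⇒≢ n<k (≡.sym k≡n))))
  ... | yes ≡.refl | inj₂ ≡.refl = trans (eval-iterᵏ-tₖ (Z′ k)) (sym (factDelta-≡ k))

  t′-upTo : ∀ n → n ≤ k → t′ n ≋ t n
  t′-upTo n n≤k = ≋-sym (T′.≋-basis n (εD′-t-upTo n n≤k))

  t′-above : ∀ n → k < n → t′ n ≋ t n -ₚ (fromℕ (n C k) * eval (Z′ k) (s (n ∸ k))) ·ₚ t k
  t′-above n k<n = ≋-sym (T′.≋-basis n λ i → begin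
    εD Z′ i (t n -ₚ α ·ₚ t k)                ≈⟨ εD--ₚ Z′ i (t n) _ ⟩
    εD Z′ i (t n) - εD Z′ i (α ·ₚ t k)       ≈⟨ +-congˡ (-‿cong (εD-·ₚ Z′ i α (t k))) ⟩
    εD Z′ i (t n) - α * εD Z′ i (t k)        ≈⟨ at i ⟩
    factDelta i n                            ∎)
    where
    binom = fromℕ (n C k)
    e = eval (Z′ k) (s (n ∸ k))
    α = binom * e
    at : ∀ i → εD Z′ i (t n) - α * εD Z′ i (t k) ≈ factDelta i n
    at i with i ≟ k
    ... | no i≢k = begin
      εD Z′ i (t n) - α * εD Z′ i (t k) ≈⟨ +-cong (εD′-t-≢ n i≢k)
                                                   (-‿cong (*-congˡ (trans (εD′-t-≢ k i≢k) (factDelta-≢ i≢k)))) ⟩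
      factDelta i n - α * 0#            ≈⟨ +-congˡ (trans (-‿cong (zeroʳ α)) -0#≈0#) ⟩
      factDelta i n + 0#                ≈⟨ +-identityʳ _ ⟩
      factDelta i n                     ∎
    ... | yes ≡.refl = begin
      εD Z′ k (t n) - α * εD Z′ k (t k) ≈⟨ +-cong (trans (eval-cong (Z′ k) (iterᵏ-t n (<⇒≤ k<n)))
                                                          (eval-·ₚ (Z′ k) _ (s (n ∸ k))))
                                                   (-‿cong (*-congˡ (eval-iterᵏ-tₖ (Z′ k)))) ⟩
      binom * f * e - binom * e * f     ≈⟨ +-congˡ (-‿cong (swap binom e f)) ⟩
      binom * f * e - binom * f * e     ≈⟨ -‿inverseʳ _ ⟩
      0#                                ≈⟨ factDelta-≢ (<⇒≢ k<n) ⟨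
      factDelta k n                     ∎
      where
      f = fromℕ (k !)
      swap : ∀ b x y → b * x * y ≈ b * y * x
      swap b x y = trans (*-assoc b x y) (trans (*-congˡ (*-comm x y)) (sym (*-assoc b y x)))

proposition3p12 : ∀ {c ℓ} (K : CommutativeRing c ℓ) → IsField K →
    let open CommutativeRing K
        open Poly K
    in CharZero →
       (D : Operator) → IsDeltaOperator D →
       (Z Z′ : ℕ → Carrier) (k : ℕ) →
       ¬ (Z k ≈ Z′ k) → (∀ i → ¬ (i ≡ k) → Z i ≈ Z′ i) →
       (t t′ s : ℕ → Pol) →
       IsGoncarovBasis D Z t → IsGoncarovBasis D Z′ t′ → IsGoncarovBasis D (tailSeq k Z) s →
       (∀ n → k < n →
          t′ n ≈ₚ t n -ₚ (fromℕ (n C k) * eval (Z′ k) (s (n ∸ k))) ·ₚ t k)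
       × (∀ n → n ≤ k → t′ n ≈ₚ t n)
proposition3p12 K field′ charZero D ((linear , _) , _) Z Z′ k _ Z≈Z′ t t′ s t-basis t′-basis s-basis =
  (λ n k<n → coeffwise (t′-above n k<n)) , (λ n n≤k → coeffwise (t′-upTo n n≤k))
  where
  open PolynomialProperties K using (coeffwise)
  open ChangeOfNode K field′ charZero D linear Z Z′ k Z≈Z′ t t′ s t-basis t′-basis s-basis
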